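{- Every ordered set is a generalized ordered set.
   Context: The setting is constructive mathematics: no use of the law of excluded middle. An ordered set is a set $X$ with a binary relation $<$ such that for all $x,y,z\in X$: (1) $x<y$ implies $\neg(y<x)$; (2) $x<y$ implies $x<z$ or $z<y$ (cotransitivity); (3) $\neg(x<y)$ and $\neg(y<x)$ imply $x=y$ (negative antisymmetry). For a set $X$ with a binary relation $<$, write $x\leq_{P}y$ if for all $z\in X$, $z<x$ implies $z<y$, and $y<z$ implies $x<z$. A generalized ordered set is a set $X$ with a binary relation $<$ such that for all $x,y,z\in X$: (asymmetry) $x<y$ implies $\neg(y<x)$; (transitivity) $x<y$ and $y<z$ imply $x<z$; (positive antisymmetry) $x\leq_{P}y$ and $y\leq_{P}x$ imply $x=y$. -}

module Defs where

open import Level using (Level; _⊔_)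
open import Data.Product using (_×_)
open import Data.Sum using (_⊎_)
open import Relation.Nullary using (¬_)
open import Relation.Binary.PropositionalEquality using (_≡_)

_≤P⟨_⟩_ : ∀ {a ℓ} {X : Set a} → X → (X → X → Set ℓ) → X → Set (a ⊔ ℓ)
x ≤P⟨ _<_ ⟩ y = ∀ z → (z < x → z < y) × (y < z → x < z)

record IsOrderedSet {a ℓ} (X : Set a) (_<_ : X → X → Set ℓ) : Set (a ⊔ ℓ) where
  field
    asym       : ∀ {x y} → x < y → ¬ (y < x)
    cotrans    : ∀ {x y} → x < y → ∀ z → (x < z) ⊎ (z < y)
    negAntisym : ∀ {x y} → ¬ (x < y) → ¬ (y < x) → x ≡ y

record IsGeneralizedOrderedSet {a ℓ} (X : Set a) (_<_ : X → X → Set ℓ) : Set (a ⊔ ℓ) where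
  field
    asym       : ∀ {x y} → x < y → ¬ (y < x)
    trans      : ∀ {x y z} → x < y → y < z → x < z
    posAntisym : ∀ {x y} → x ≤P⟨ _<_ ⟩ y → y ≤P⟨ _<_ ⟩ x → x ≡ y

-- Transitivity: cotransitivity splits x < y at z into x < z or z < y, and z < y contradicts
-- y < z. Positive antisymmetry: x ≤P y turns y < x into y < y, so mutual ≤P rules out both
-- x < y and y < x, and negative antisymmetry applies.
module Submission where

open import Defs
open import Data.Product using (proj₁)
open import Data.Sum using ([_,_]′)
open import Data.Empty using (⊥-elim)
open import Function using (_∘_)
open import Relation.Nullary using (¬_)
open import Relation.Binary.Definitions using (Asymmetric; Cotransitive; Transitive)

module _ {a ℓ} {X : Set a} (_<_ : X → X → Set ℓ) where

  asym⇒irrefl : Asymmetric _<_ → ∀ {x} → ¬ (x < x)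
  asym⇒irrefl asym x<x = asym x<x x<x

  asym∧cotrans⇒trans : Asymmetric _<_ → Cotransitive _<_ → Transitive _<_
  asym∧cotrans⇒trans asym cotrans {k = z} x<y y<z =
    [ (λ x<z → x<z) , (λ z<y → ⊥-elim (asym y<z z<y)) ]′ (cotrans x<y z)

  ≤P⇒≯ : Asymmetric _<_ → ∀ {x y} → x ≤P⟨ _<_ ⟩ y → ¬ (y < x)
  ≤P⇒≯ asym {y = y} x≤y = asym⇒irrefl asym ∘ proj₁ (x≤y y)

theorem7 : ∀ {a ℓ} (X : Set a) (_<_ : X → X → Set ℓ) → IsOrderedSet X _<_ → IsGeneralizedOrderedSet X _<_
theorem7 X _<_ isOrderedSet = record
  { asym       = asym
  ; trans      = asym∧cotrans⇒trans _<_ asym cotrans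
  ; posAntisym = λ x≤y y≤x → negAntisym (≤P⇒≯ _<_ asym y≤x) (≤P⇒≯ _<_ asym x≤y)
  }
  where open IsOrderedSet isOrderedSet
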